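{- Fix integers $s,t\ge 3$ with $R(s-1,t)\ge R(s,t-1)$, and set $M=R(s-1,t)$ and $m=R(s,t-1)$. Then for every positive integer $r$, $$R^{\mathrm{KG}}_r(s,t)\le (M+1)r+m-1.$$ In particular, for every $s\ge 3$ and every positive integer $r$, $R^{\mathrm{KG}}_r(s,s)\le (R(s,s-1)+1)r+R(s,s-1)-1$.
   Context: $R(s,t)$ is the classical Ramsey number: the least $n$ such that every red/blue edge-coloring of $K_n$ contains a red $K_s$ or a blue $K_t$. The Kneser graph $\mathrm{KG}(n,r)$ has vertex set the $r$-element subsets of $[n]=\{1,\dots,n\}$, with two sets adjacent iff they are disjoint. The $r$-Kneser Ramsey number $R^{\mathrm{KG}}_r(s,t)$ is the minimum integer $n$ such that every red/blue edge-coloring of $\mathrm{KG}(n,r)$ contains a red $K_s$ (a set of $s$ pairwise adjacent vertices with all connecting edges red) or a blue $K_t$. -}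

module Defs where

open import Data.Nat using (ℕ; _≤_; _∸_)
open import Data.Bool using (Bool; true; false)
open import Data.Fin using (Fin)
open import Data.Fin.Subset using (Subset; _∩_; ⊥; ∣_∣)
open import Data.Product using (Σ; _×_; ∃)
open import Data.Sum using (_⊎_)
open import Relation.Binary.PropositionalEquality using (_≡_; _≢_)
open import Function.Definitions using (Injective)

-- Colour convention: true = red, false = blue.

-- A red/blue edge-colouring of K_n: a symmetric map on pairs of vertices
-- (its values on the diagonal are irrelevant).
SymColouring : ℕ → Set
SymColouring n = Σ (Fin n → Fin n → Bool) λ c → ∀ x y → c x y ≡ c y x

MonoClique : ∀ {n} → (Fin n → Fin n → Bool) → Bool → ℕ → Set
MonoClique {n} c b k =
  Σ (Fin k → Fin n) λ v → Injective _≡_ _≡_ v × (∀ i j → i ≢ j → c (v i) (v j) ≡ b)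

Arrows : ℕ → ℕ → ℕ → Set
Arrows n s t = (c : SymColouring n) →
  MonoClique (Σ.proj₁ c) true s ⊎ MonoClique (Σ.proj₁ c) false t

IsRamseyNumber : ℕ → ℕ → ℕ → Set
IsRamseyNumber s t R = Arrows R s t × (∀ n → Arrows n s t → R ≤ n)

KVertex : ℕ → ℕ → Set
KVertex n r = Σ (Subset n) λ A → ∣ A ∣ ≡ r

KAdj : ∀ {n r} → KVertex n r → KVertex n r → Set
KAdj A B = Σ.proj₁ A ∩ Σ.proj₁ B ≡ ⊥

-- A red/blue edge-colouring of KG(n,r): a symmetric map on pairs of vertices
-- (only its values on adjacent pairs matter).
KColouring : ℕ → ℕ → Set
KColouring n r = Σ (KVertex n r → KVertex n r → Bool) λ c → ∀ A B → c A B ≡ c B A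

KMonoClique : ∀ {n r} → (KVertex n r → KVertex n r → Bool) → Bool → ℕ → Set
KMonoClique {n} {r} c b k =
  Σ (Fin k → KVertex n r) λ v → Injective _≡_ _≡_ v ×
    (∀ i j → i ≢ j → KAdj (v i) (v j) × c (v i) (v j) ≡ b)

KArrows : ℕ → ℕ → ℕ → ℕ → Set
KArrows r n s t = (c : KColouring n r) →
  KMonoClique (Σ.proj₁ c) true s ⊎ KMonoClique (Σ.proj₁ c) false t

-- R^KG_r(s,t) ≤ N : the least n with KArrows r n s t is at most N,
-- i.e. some n ≤ N has the arrowing property.
KRamseyAtMost : ℕ → ℕ → ℕ → ℕ → Set
KRamseyAtMost r s t N = ∃ λ n → n ≤ N × KArrows r n s t

-- Fix an r-set X ⊆ [N] and colour every r-subset A of its complement G by the colour of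
-- the Kneser edge XA.  Any red and any blue r-subset of G are joined by a chain of
-- single-element exchanges, so some (r+1)-subset of G contains r-sets of both colours;
-- deleting it and repeating shows that G, of size Mr + m - 1, contains M pairwise disjoint
-- red r-sets or m pairwise disjoint blue ones.  Such a family is a clique of KG(N,r) joined
-- to X in a single colour, so applying R(s-1,t) ≤ M, resp. R(s,t-1) ≤ m, to the colouring
-- inside the family gives either the required clique directly or one that X extends.

module Submission where

open import Defs
open import Data.Bool using (Bool; true; false; not) renaming (_≟_ to _≟ᵇ_)
open import Data.Bool.Properties using (¬-not; not-injective)
open import Data.Fin using (Fin; zero; suc)
open import Data.Fin.Properties using () renaming (_≟_ to _≟ᶠ_; suc-injective to sucᶠ-injective)
open import Data.Fin.Subset
open import Data.Fin.Subset.Properties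
open import Data.Nat using (ℕ; zero; suc; _+_; _*_; _∸_; _≤_; _<_; z≤n; s≤s)
open import Data.Nat.Properties
open import Data.Nat.Tactic.RingSolver using (solve-∀)
open import Data.Product using (Σ; ∃; _×_; _,_; proj₁; proj₂)
open import Data.Sum using (_⊎_; inj₁; inj₂; [_,_]′) renaming (map to ⊎-map)
open import Data.Vec using ([]; _∷_; here; there)
open import Data.Vec.Functional using () renaming (_∷_ to _∷ᶠ_)
open import Function using (_∘_)
open import Function.Definitions using (Injective)
open import Relation.Binary.PropositionalEquality
open import Relation.Nullary using (¬_; Dec; yes; no; contradiction)
open import Relation.Nullary.Decidable using (map′; _×-dec_)

private
  variable
    n k r : ℕ
    p q : Subset n

x∈p─q⁻ : ∀ (p q : Subset n) {x} → x ∈ p ─ q → x ∈ p × x ∉ q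
x∈p─q⁻ p q x∈p─q = p─q⊆p p q x∈p─q , x∉q p q x∈p─q
  where
  x∉q : ∀ (p q : Subset n) {x} → x ∈ p ─ q → x ∉ q
  x∉q (_ ∷ p) (_ ∷ q)      (there x∈p─q) (there x∈q) = x∉q p q x∈p─q x∈q
  x∉q (_ ∷ p) (inside ∷ q) ()            here

p∪⁅x⁆⊆q : ∀ {x} → p ⊆ q → x ∈ q → p ∪ ⁅ x ⁆ ⊆ q
p∪⁅x⁆⊆q {p = p} {x = x} p⊆q x∈q z∈p∪⁅x⁆ with x∈p∪q⁻ p ⁅ x ⁆ z∈p∪⁅x⁆
... | inj₁ z∈p    = p⊆q z∈p
... | inj₂ z∈⁅x⁆ = subst (_∈ _) (sym (x∈⁅y⁆⇒x≡y x z∈⁅x⁆)) x∈q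

p∩q≡⊥⁺ : (∀ {x} → x ∈ p → x ∉ q) → p ∩ q ≡ ⊥
p∩q≡⊥⁺ {p = p} {q} p∉q = Empty-unique λ (x , x∈p∩q) →
  let x∈p , x∈q = x∈p∩q⁻ p q x∈p∩q in p∉q x∈p x∈q

p∩q≡⊥⁻ : ∀ {x} → p ∩ q ≡ ⊥ → x ∈ p → x ∉ q
p∩q≡⊥⁻ p∩q≡⊥ x∈p x∈q = ∉⊥ (subst (_ ∈_) p∩q≡⊥ (x∈p∩q⁺ (x∈p , x∈q)))

∣p─q∣+∣p∩q∣≡∣p∣ : ∀ (p q : Subset n) → ∣ p ─ q ∣ + ∣ p ∩ q ∣ ≡ ∣ p ∣
∣p─q∣+∣p∩q∣≡∣p∣ []            []            = refl
∣p─q∣+∣p∩q∣≡∣p∣ (inside  ∷ p) (inside  ∷ q) = trans (+-suc _ _) (cong suc (∣p─q∣+∣p∩q∣≡∣p∣ p q))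
∣p─q∣+∣p∩q∣≡∣p∣ (inside  ∷ p) (outside ∷ q) = cong suc (∣p─q∣+∣p∩q∣≡∣p∣ p q)
∣p─q∣+∣p∩q∣≡∣p∣ (outside ∷ p) (inside  ∷ q) = ∣p─q∣+∣p∩q∣≡∣p∣ p q
∣p─q∣+∣p∩q∣≡∣p∣ (outside ∷ p) (outside ∷ q) = ∣p─q∣+∣p∩q∣≡∣p∣ p q

q⊆p⇒∣p─q∣+∣q∣≡∣p∣ : ∀ (p q : Subset n) → q ⊆ p → ∣ p ─ q ∣ + ∣ q ∣ ≡ ∣ p ∣
q⊆p⇒∣p─q∣+∣q∣≡∣p∣ []            []            _   = refl
q⊆p⇒∣p─q∣+∣q∣≡∣p∣ (inside  ∷ p) (inside  ∷ q) q⊆p =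
  trans (+-suc _ _) (cong suc (q⊆p⇒∣p─q∣+∣q∣≡∣p∣ p q (drop-∷-⊆ q⊆p)))
q⊆p⇒∣p─q∣+∣q∣≡∣p∣ (inside  ∷ p) (outside ∷ q) q⊆p = cong suc (q⊆p⇒∣p─q∣+∣q∣≡∣p∣ p q (drop-∷-⊆ q⊆p))
q⊆p⇒∣p─q∣+∣q∣≡∣p∣ (outside ∷ p) (inside  ∷ q) q⊆p = contradiction (q⊆p here) λ ()
q⊆p⇒∣p─q∣+∣q∣≡∣p∣ (outside ∷ p) (outside ∷ q) q⊆p = q⊆p⇒∣p─q∣+∣q∣≡∣p∣ p q (drop-∷-⊆ q⊆p)

∣p-x∣+1≡∣p∣ : ∀ {x} → x ∈ p → suc ∣ p - x ∣ ≡ ∣ p ∣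
∣p-x∣+1≡∣p∣ {p = p} {x} x∈p = begin
  suc ∣ p - x ∣          ≡⟨ +-comm 1 _ ⟩
  ∣ p - x ∣ + 1          ≡⟨ cong (∣ p - x ∣ +_) (∣⁅x⁆∣≡1 x) ⟨
  ∣ p - x ∣ + ∣ ⁅ x ⁆ ∣  ≡⟨ q⊆p⇒∣p─q∣+∣q∣≡∣p∣ p ⁅ x ⁆ ⁅x⁆⊆p ⟩
  ∣ p ∣                  ∎
  where
  open ≡-Reasoning
  ⁅x⁆⊆p : ⁅ x ⁆ ⊆ p
  ⁅x⁆⊆p y∈⁅x⁆ = subst (_∈ p) (sym (x∈⁅y⁆⇒x≡y x y∈⁅x⁆)) x∈p

∣p∪⁅x⁆∣≡1+∣p∣ : ∀ (p : Subset n) x → x ∉ p → ∣ p ∪ ⁅ x ⁆ ∣ ≡ suc ∣ p ∣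
∣p∪⁅x⁆∣≡1+∣p∣ (outside ∷ p) zero    _   = cong (λ q → suc ∣ q ∣) (∪-identityʳ p)
∣p∪⁅x⁆∣≡1+∣p∣ (inside  ∷ p) zero    x∉p = contradiction here x∉p
∣p∪⁅x⁆∣≡1+∣p∣ (inside  ∷ p) (suc x) x∉p = cong suc (∣p∪⁅x⁆∣≡1+∣p∣ p x (x∉p ∘ there))
∣p∪⁅x⁆∣≡1+∣p∣ (outside ∷ p) (suc x) x∉p = ∣p∪⁅x⁆∣≡1+∣p∣ p x (x∉p ∘ there)

∣p─q∣≡∣q─p∣ : ∀ (p q : Subset n) → ∣ p ∣ ≡ ∣ q ∣ → ∣ p ─ q ∣ ≡ ∣ q ─ p ∣
∣p─q∣≡∣q─p∣ p q ∣p∣≡∣q∣ = +-cancelʳ-≡ ∣ p ∩ q ∣ _ _ (begin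
  ∣ p ─ q ∣ + ∣ p ∩ q ∣  ≡⟨ ∣p─q∣+∣p∩q∣≡∣p∣ p q ⟩
  ∣ p ∣                  ≡⟨ ∣p∣≡∣q∣ ⟩
  ∣ q ∣                  ≡⟨ ∣p─q∣+∣p∩q∣≡∣p∣ q p ⟨
  ∣ q ─ p ∣ + ∣ q ∩ p ∣  ≡⟨ cong (λ s → ∣ q ─ p ∣ + ∣ s ∣) (∩-comm q p) ⟩
  ∣ q ─ p ∣ + ∣ p ∩ q ∣  ∎)
  where open ≡-Reasoning

Empty⇒∣p∣≡0 : ∀ {n} {p : Subset n} → Empty p → ∣ p ∣ ≡ 0
Empty⇒∣p∣≡0 {n} empty = trans (cong ∣_∣ (Empty-unique empty)) (∣⊥∣≡0 n)

∣p∣≡0⇒Empty : ∣ p ∣ ≡ 0 → Empty p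
∣p∣≡0⇒Empty ∣p∣≡0 (x , x∈p) = m<n⇒n≢0 (x∈p⇒∣p-x∣<∣p∣ x∈p) ∣p∣≡0

∣p∣≢0⇒Nonempty : ∣ p ∣ ≢ 0 → Nonempty p
∣p∣≢0⇒Nonempty {p = p} ∣p∣≢0 with nonempty? p
... | yes nonempty = nonempty
... | no  empty    = contradiction (Empty⇒∣p∣≡0 empty) ∣p∣≢0

Empty[p─q]⇒p⊆q : Empty (p ─ q) → p ⊆ q
Empty[p─q]⇒p⊆q {q = q} empty {x} x∈p with x ∈? q
... | yes x∈q = x∈q
... | no  x∉q = contradiction (x , x∈p∧x∉q⇒x∈p─q x∈p x∉q) empty

p≢q⇒Nonempty[p─q] : ∀ (p q : Subset n) → ∣ p ∣ ≡ ∣ q ∣ → p ≢ q → Nonempty (p ─ q)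
p≢q⇒Nonempty[p─q] p q ∣p∣≡∣q∣ p≢q with nonempty? (p ─ q)
... | yes nonempty = nonempty
... | no  empty    = contradiction (⊆-antisym (Empty[p─q]⇒p⊆q empty) (Empty[p─q]⇒p⊆q empty′)) p≢q
  where
  empty′ : Empty (q ─ p)
  empty′ = ∣p∣≡0⇒Empty (trans (sym (∣p─q∣≡∣q─p∣ p q ∣p∣≡∣q∣)) (Empty⇒∣p∣≡0 empty))

⊆-ofSize : ∀ {n r} (p : Subset n) → r ≤ ∣ p ∣ → ∃ λ q → q ⊆ p × ∣ q ∣ ≡ r
⊆-ofSize {n} {zero} p _ = ⊥ , ⊥⊆ , ∣⊥∣≡0 n
⊆-ofSize {r = suc r} (inside  ∷ p) (s≤s r≤) with ⊆-ofSize p r≤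
... | q , q⊆p , ∣q∣≡r = inside ∷ q , s⊆s q⊆p , cong suc ∣q∣≡r
⊆-ofSize {r = suc r} (outside ∷ p) r≤       with ⊆-ofSize p r≤
... | q , q⊆p , ∣q∣≡r = outside ∷ q , s⊆s q⊆p , ∣q∣≡r

module Exchange {R B : Subset n} {x y} (x∈R─B : x ∈ R ─ B) (y∈B─R : y ∈ B ─ R) where

  T : Subset n
  T = R ∪ ⁅ y ⁆

  S : Subset n
  S = T - x

  ∣T∣≡1+∣R∣ : ∣ T ∣ ≡ suc ∣ R ∣
  ∣T∣≡1+∣R∣ = ∣p∪⁅x⁆∣≡1+∣p∣ R y (proj₂ (x∈p─q⁻ B R y∈B─R))

  R⊆T : R ⊆ T
  R⊆T = p⊆p∪q ⁅ y ⁆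

  ∣S∣≡∣R∣ : ∣ S ∣ ≡ ∣ R ∣
  ∣S∣≡∣R∣ = suc-injective (trans (∣p-x∣+1≡∣p∣ (R⊆T (proj₁ (x∈p─q⁻ R B x∈R─B)))) ∣T∣≡1+∣R∣)

  S⊆T : S ⊆ T
  S⊆T = p─q⊆p T ⁅ x ⁆

  T⊆G : ∀ {G} → R ⊆ G → B ⊆ G → T ⊆ G
  T⊆G R⊆G B⊆G = p∪⁅x⁆⊆q R⊆G (B⊆G (proj₁ (x∈p─q⁻ B R y∈B─R)))

  ∣S─B∣<∣R─B∣ : ∣ S ─ B ∣ < ∣ R ─ B ∣
  ∣S─B∣<∣R─B∣ = ≤-<-trans (p⊆q⇒∣p∣≤∣q∣ S─B⊆[R─B]-x) (x∈p⇒∣p-x∣<∣p∣ x∈R─B)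
    where
    S─B⊆[R─B]-x : S ─ B ⊆ (R ─ B) - x
    S─B⊆[R─B]-x z∈S─B with x∈p─q⁻ S B z∈S─B
    ... | z∈S , z∉B with x∈p─q⁻ T ⁅ x ⁆ z∈S
    ...   | z∈T , z∉⁅x⁆ with x∈p∪q⁻ R ⁅ y ⁆ z∈T
    ...     | inj₁ z∈R    = x∈p∧x∉q⇒x∈p─q (x∈p∧x∉q⇒x∈p─q z∈R z∉B) z∉⁅x⁆
    ...     | inj₂ z∈⁅y⁆ =
      contradiction (subst (_∈ B) (sym (x∈⁅y⁆⇒x≡y y z∈⁅y⁆)) (proj₁ (x∈p─q⁻ B R y∈B─R))) z∉B

KVertex-≡ : ∀ {A B : KVertex n r} → proj₁ A ≡ proj₁ B → A ≡ B
KVertex-≡ {A = p , e} {B = .p , e′} refl = cong (p ,_) (≡-irrelevant e e′)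

anyVertex? : ∀ {P : KVertex n r → Set} → (∀ A → Dec (P A)) → Dec (∃ P)
anyVertex? {n} {r} {P} P? =
  map′ (λ (p , e , Pp) → (p , e) , Pp) (λ ((p , e) , Pp) → p , e , Pp) (anySubset? Q?)
  where
  Q? : ∀ p → Dec (Σ (∣ p ∣ ≡ r) λ e → P (p , e))
  Q? p with ∣ p ∣ ≟ r
  ... | no  ∣p∣≢r = no (∣p∣≢r ∘ proj₁)
  ... | yes e     = map′ (e ,_) (λ (e′ , Pp) → subst (λ e → P (p , e)) (≡-irrelevant e′ e) Pp) (P? (p , e))

KAdj-sym : ∀ (A B : KVertex n r) → KAdj A B → KAdj B A
KAdj-sym A B = trans (∩-comm (proj₁ B) (proj₁ A))

KAdj-irrefl : 1 ≤ r → (A : KVertex n r) → ¬ KAdj A A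
KAdj-irrefl 1≤r (p , ∣p∣≡r) adj with ∣p∣≢0⇒Nonempty (m<n⇒n≢0 (subst (1 ≤_) (sym ∣p∣≡r) 1≤r))
... | x , x∈p = p∩q≡⊥⁻ adj x∈p x∈p

PairwiseAdjacent : (Fin k → KVertex n r) → Set
PairwiseAdjacent V = ∀ i j → i ≢ j → KAdj (V i) (V j)

PairwiseAdjacent-∷ : ∀ {A : KVertex n r} {V : Fin k → KVertex n r} →
                     (∀ i → KAdj A (V i)) → PairwiseAdjacent V → PairwiseAdjacent (A ∷ᶠ V)
PairwiseAdjacent-∷         A-adj V-adj zero    zero    0≢0 = contradiction refl 0≢0
PairwiseAdjacent-∷         A-adj V-adj zero    (suc j) _   = A-adj j
PairwiseAdjacent-∷ {A = A} {V} A-adj V-adj (suc i) zero _  = KAdj-sym A (V i) (A-adj i)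
PairwiseAdjacent-∷         A-adj V-adj (suc i) (suc j) i≢j = V-adj i j (i≢j ∘ cong suc)

PairwiseAdjacent⇒Injective : ∀ {V : Fin k → KVertex n r} → 1 ≤ r → PairwiseAdjacent V → Injective _≡_ _≡_ V
PairwiseAdjacent⇒Injective {V = V} 1≤r adj {i} {j} Vi≡Vj with i ≟ᶠ j
... | yes i≡j = i≡j
... | no  i≢j = contradiction (subst (KAdj (V i)) (sym Vi≡Vj) (adj i j i≢j)) (KAdj-irrefl 1≤r (V i))

MonoClique-cone : ∀ {k m b} (c : Fin (suc k) → Fin (suc k) → Bool) →
                  (∀ j → c zero (suc j) ≡ b) → (∀ j → c (suc j) zero ≡ b) →
                  MonoClique (λ i j → c (suc i) (suc j)) b m → MonoClique c b (suc m)
MonoClique-cone {b = b} c c₀ c₀′ (v , v-inj , v-mono) = w , w-inj , w-mono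
  where
  w = zero ∷ᶠ (suc ∘ v)
  w-inj : Injective _≡_ _≡_ w
  w-inj {zero}  {zero}  _  = refl
  w-inj {suc i} {suc j} eq = cong suc (v-inj (sucᶠ-injective eq))
  w-mono : ∀ i j → i ≢ j → c (w i) (w j) ≡ b
  w-mono zero    zero    0≢0 = contradiction refl 0≢0
  w-mono zero    (suc j) _   = c₀ (v j)
  w-mono (suc i) zero    _   = c₀′ (v i)
  w-mono (suc i) (suc j) i≢j = v-mono i j (i≢j ∘ cong suc)

MonoClique⇒KMonoClique : ∀ {k m b} → 1 ≤ r → (c : KVertex n r → KVertex n r → Bool) →
                         {V : Fin k → KVertex n r} → PairwiseAdjacent V →
                         MonoClique (λ i j → c (V i) (V j)) b m → KMonoClique c b m
MonoClique⇒KMonoClique 1≤r c {V} V-adj (v , v-inj , v-mono) =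
  V ∘ v , v-inj ∘ PairwiseAdjacent⇒Injective {V = V} 1≤r V-adj ,
  λ i j i≢j → V-adj (v i) (v j) (i≢j ∘ v-inj) , v-mono i j i≢j

Packing : (KVertex n r → Set) → ℕ → Subset n → Set
Packing {n} {r} P k G = Σ (Fin k → KVertex n r) λ V → (∀ i → proj₁ (V i) ⊆ G × P (V i)) × PairwiseAdjacent V

Packing-cons : ∀ {P : KVertex n r → Set} {A T G} →
               P A → proj₁ A ⊆ T → T ⊆ G → Packing P k (G ─ T) → Packing P (suc k) G
Packing-cons {P = P} {A} {T} {G} PA A⊆T T⊆G (V , V∈ , V-adj) = A ∷ᶠ V , A∷V∈ , PairwiseAdjacent-∷ A-adj V-adj
  where
  A∷V∈ : ∀ i → proj₁ ((A ∷ᶠ V) i) ⊆ G × P ((A ∷ᶠ V) i)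
  A∷V∈ zero    = ⊆-trans A⊆T T⊆G , PA
  A∷V∈ (suc i) = ⊆-trans (proj₁ (V∈ i)) (p─q⊆p G T) , proj₂ (V∈ i)
  A-adj : ∀ i → KAdj A (V i)
  A-adj i = p∩q≡⊥⁺ λ x∈A x∈Vi → proj₂ (x∈p─q⁻ G T (proj₁ (V∈ i) x∈Vi)) (A⊆T x∈A)

Packing-extract : ∀ {P : KVertex n r → Set} k G → k * r ≤ ∣ G ∣ → (∀ A → proj₁ A ⊆ G → P A) → Packing P k G
Packing-extract zero G _ _ = (λ ()) , (λ ()) , (λ ())
Packing-extract {r = r} {P} (suc k) G r+kr≤∣G∣ P-on-G with ⊆-ofSize G (m+n≤o⇒m≤o r r+kr≤∣G∣)
... | A , A⊆G , ∣A∣≡r =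
  Packing-cons {P = P} (P-on-G (A , ∣A∣≡r) A⊆G) ⊆-refl A⊆G
    (Packing-extract k (G ─ A) kr≤∣G─A∣ λ B B⊆G─A → P-on-G B (⊆-trans B⊆G─A (p─q⊆p G A)))
  where
  kr≤∣G─A∣ : k * r ≤ ∣ G ─ A ∣
  kr≤∣G─A∣ = +-cancelʳ-≤ r _ _ (begin
    k * r + r          ≡⟨ +-comm (k * r) r ⟩
    r + k * r          ≤⟨ r+kr≤∣G∣ ⟩
    ∣ G ∣              ≡⟨ q⊆p⇒∣p─q∣+∣q∣≡∣p∣ G A A⊆G ⟨
    ∣ G ─ A ∣ + ∣ A ∣  ≡⟨ cong (∣ G ─ A ∣ +_) ∣A∣≡r ⟩
    ∣ G ─ A ∣ + r      ∎)
    where open ≤-Reasoning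

m+1+n≤1+o⇒m≤o : ∀ m {n o} → m + suc n ≤ suc o → m ≤ o
m+1+n≤1+o⇒m≤o m {n} {o} m+1+n≤1+o = m+n≤o⇒m≤o m (≤-pred (subst (_≤ suc o) (+-suc m n) m+1+n≤1+o))

module _ {n r : ℕ} (f : KVertex n r → Bool) where

  Coloured : Bool → KVertex n r → Set
  Coloured b A = f A ≡ b

  Bichromatic : Subset n → Set
  Bichromatic T = (∃ λ A → proj₁ A ⊆ T × Coloured true A) × (∃ λ A → proj₁ A ⊆ T × Coloured false A)

  -- Exchanges walk from R towards B until the colour flips; d bounds the number of steps.
  bichromatic-subset : ∀ d (R B : KVertex n r) {G} → ∣ proj₁ R ─ proj₁ B ∣ < d →
                       proj₁ R ⊆ G → proj₁ B ⊆ G → f R ≡ true → f B ≡ false →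
                       ∃ λ T → T ⊆ G × ∣ T ∣ ≡ suc r × Bichromatic T
  bichromatic-subset (suc d) R B {G} ∣R─B∣<1+d R⊆G B⊆G fR fB = exchange
    (p≢q⇒Nonempty[p─q] (proj₁ R) (proj₁ B) ∣R∣≡∣B∣ R≢B)
    (p≢q⇒Nonempty[p─q] (proj₁ B) (proj₁ R) (sym ∣R∣≡∣B∣) (R≢B ∘ sym))
    where
    ∣R∣≡∣B∣ : ∣ proj₁ R ∣ ≡ ∣ proj₁ B ∣
    ∣R∣≡∣B∣ = trans (proj₂ R) (sym (proj₂ B))
    R≢B : proj₁ R ≢ proj₁ B
    R≢B R≡B = contradiction (trans (sym fR) (trans (cong f (KVertex-≡ R≡B)) fB)) λ ()
    exchange : Nonempty (proj₁ R ─ proj₁ B) → Nonempty (proj₁ B ─ proj₁ R) →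
               ∃ λ T → T ⊆ G × ∣ T ∣ ≡ suc r × Bichromatic T
    exchange (x , x∈R─B) (y , y∈B─R) = recolour (f S′) refl
      where
      open Exchange x∈R─B y∈B─R
      S′ : KVertex n r
      S′ = S , trans ∣S∣≡∣R∣ (proj₂ R)
      recolour : ∀ b → f S′ ≡ b → ∃ λ T → T ⊆ G × ∣ T ∣ ≡ suc r × Bichromatic T
      recolour false fS′ = T , T⊆G R⊆G B⊆G , trans ∣T∣≡1+∣R∣ (cong suc (proj₂ R)) ,
                           (R , R⊆T , fR) , (S′ , S⊆T , fS′)
      recolour true  fS′ = bichromatic-subset d S′ B (<-≤-trans ∣S─B∣<∣R─B∣ (≤-pred ∣R─B∣<1+d))
                             (⊆-trans S⊆T (T⊆G R⊆G B⊆G)) B⊆G fS′ fB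

  packing-dichotomy : ∀ a b (G : Subset n) → b ≤ a → a * r + b ≤ suc ∣ G ∣ →
                      Packing (Coloured true) a G ⊎ Packing (Coloured false) b G
  packing-dichotomy a       zero    G _         _     = inj₂ ((λ ()) , (λ ()) , (λ ()))
  packing-dichotomy (suc a) (suc b) G (s≤s b≤a) bound
    with anyVertex? (λ A → proj₁ A ⊆? G ×-dec f A ≟ᵇ false)
  ... | no ∄blue = inj₁ (Packing-extract {P = Coloured true} (suc a) G (m+1+n≤1+o⇒m≤o (suc a * r) bound)
                           λ A A⊆G → ¬-not λ fA → ∄blue (A , A⊆G , fA))
  ... | yes (B , B⊆G , fB) with anyVertex? (λ A → proj₁ A ⊆? G ×-dec f A ≟ᵇ true)
  ...   | no ∄red = inj₂ (Packing-extract {P = Coloured false} (suc b) G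
                            (≤-trans (*-monoˡ-≤ r (s≤s b≤a)) (m+1+n≤1+o⇒m≤o (suc a * r) bound))
                            λ A A⊆G → ¬-not λ fA → ∄red (A , A⊆G , fA))
  ...   | yes (R , R⊆G , fR) with bichromatic-subset (suc ∣ proj₁ R ─ proj₁ B ∣) R B ≤-refl R⊆G B⊆G fR fB
  ...     | T , T⊆G , ∣T∣≡1+r , (R′ , R′⊆T , fR′) , (B′ , B′⊆T , fB′)
          with packing-dichotomy a b (G ─ T) b≤a bound′
    where
    bound′ : a * r + b ≤ suc ∣ G ─ T ∣
    bound′ = +-cancelʳ-≤ (suc r) _ _ (begin
      a * r + b + suc r      ≡⟨ rearrange a b r ⟩
      suc a * r + suc b      ≤⟨ bound ⟩
      suc ∣ G ∣              ≡⟨ cong suc (q⊆p⇒∣p─q∣+∣q∣≡∣p∣ G T T⊆G) ⟨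
      suc ∣ G ─ T ∣ + ∣ T ∣  ≡⟨ cong (suc ∣ G ─ T ∣ +_) ∣T∣≡1+r ⟩
      suc ∣ G ─ T ∣ + suc r  ∎)
      where
      open ≤-Reasoning
      rearrange : ∀ a b r → a * r + b + suc r ≡ suc a * r + suc b
      rearrange = solve-∀
  ...       | inj₁ reds  = inj₁ (Packing-cons {P = Coloured true}  fR′ R′⊆T T⊆G reds)
  ...       | inj₂ blues = inj₂ (Packing-cons {P = Coloured false} fB′ B′⊆T T⊆G blues)

module _ {n r} (1≤r : 1 ≤ r) (c : KVertex n r → KVertex n r → Bool) (c-sym : ∀ A B → c A B ≡ c B A)
         (X : KVertex n r) {k b} (packing : Packing (Coloured (c X) b) k (∁ (proj₁ X))) where

  private
    V : Fin k → KVertex n r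
    V = proj₁ packing

  packingColouring : SymColouring k
  packingColouring = (λ i j → c (V i) (V j)) , λ i j → c-sym (V i) (V j)

  packing-lift : ∀ {m b′} → MonoClique (proj₁ packingColouring) b′ m → KMonoClique c b′ m
  packing-lift = MonoClique⇒KMonoClique 1≤r c {V} (proj₂ (proj₂ packing))

  packing-cone : ∀ {m} → MonoClique (proj₁ packingColouring) b m → KMonoClique c b (suc m)
  packing-cone clique =
    MonoClique⇒KMonoClique 1≤r c {X ∷ᶠ V} (PairwiseAdjacent-∷ {A = X} {V} X-adj (proj₂ (proj₂ packing)))
      (MonoClique-cone (λ i j → c ((X ∷ᶠ V) i) ((X ∷ᶠ V) j)) cXV (λ j → trans (c-sym (V j) X) (cXV j)) clique)
    where
    X-adj : ∀ i → KAdj X (V i)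
    X-adj i = p∩q≡⊥⁺ λ x∈X x∈Vi → x∈∁p⇒x∉p (proj₁ (proj₁ (proj₂ packing) i) x∈Vi) x∈X
    cXV : ∀ j → c X (V j) ≡ b
    cXV j = proj₂ (proj₁ (proj₂ packing) j)

Arrows-sym : ∀ {n s t} → Arrows n s t → Arrows n t s
Arrows-sym arrows (c , c-sym) with arrows ((λ x y → not (c x y)) , λ x y → cong not (c-sym x y))
... | inj₁ (v , v-inj , v-mono) = inj₂ (v , v-inj , λ i j i≢j → not-injective {y = false} (v-mono i j i≢j))
... | inj₂ (v , v-inj , v-mono) = inj₁ (v , v-inj , λ i j i≢j → not-injective {y = true} (v-mono i j i≢j))

Arrows⇒1≤ : ∀ {n s t} → Arrows n (suc s) (suc t) → 1 ≤ n
Arrows⇒1≤ {zero} arrows with arrows ((λ ()) , λ ())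
... | inj₁ (v , _) = contradiction (v zero) λ ()
... | inj₂ (v , _) = contradiction (v zero) λ ()
Arrows⇒1≤ {suc n} _ = s≤s z≤n

kneser-arrows : ∀ {r s t M m} → 1 ≤ r → 1 ≤ m → m ≤ M → Arrows M s (suc t) → Arrows m (suc s) t →
                KArrows r ((M + 1) * r + m ∸ 1) (suc s) (suc t)
kneser-arrows {r} {M = M} {suc m} 1≤r _ m≤M arrowsM arrowsm (c , c-sym) =
  [ (λ reds  → ⊎-map (packing-cone 1≤r c c-sym X reds) (packing-lift 1≤r c c-sym X reds)
                     (arrowsM (packingColouring 1≤r c c-sym X reds)))
  , (λ blues → ⊎-map (packing-lift 1≤r c c-sym X blues) (packing-cone 1≤r c c-sym X blues)
                     (arrowsm (packingColouring 1≤r c c-sym X blues)))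
  ]′ (packing-dichotomy (c X) M (suc m) G m≤M bound)
  where
  N : ℕ
  N = (M + 1) * r + suc m ∸ 1
  N≡r+[Mr+m] : N ≡ r + (M * r + m)
  N≡r+[Mr+m] = trans (cong (_∸ 1) (+-suc ((M + 1) * r) m)) (regroup M r m)
    where
    regroup : ∀ M r m → (M + 1) * r + m ≡ r + (M * r + m)
    regroup = solve-∀
  X : KVertex N r
  X = let p , _ , ∣p∣≡r = ⊆-ofSize ⊤ (subst (r ≤_) (trans (sym N≡r+[Mr+m]) (sym (∣⊤∣≡n N))) (m≤m+n r _))
      in p , ∣p∣≡r
  G : Subset N
  G = ∁ (proj₁ X)
  bound : M * r + suc m ≤ suc ∣ G ∣
  bound = ≤-reflexive (begin
    M * r + suc m              ≡⟨ +-suc (M * r) m ⟩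
    suc (M * r + m)            ≡⟨ cong suc (m+n∸m≡n r (M * r + m)) ⟨
    suc (r + (M * r + m) ∸ r)  ≡⟨ cong₂ (λ a b → suc (a ∸ b)) N≡r+[Mr+m] (proj₂ X) ⟨
    suc (N ∸ ∣ proj₁ X ∣)      ≡⟨ cong suc (∣∁p∣≡n∸∣p∣ (proj₁ X)) ⟨
    suc ∣ G ∣                  ∎)
    where open ≡-Reasoning

theorem1p7 :
    (∀ (s t M m : ℕ) → 3 ≤ s → 3 ≤ t →
       IsRamseyNumber (s ∸ 1) t M → IsRamseyNumber s (t ∸ 1) m → m ≤ M →
       ∀ (r : ℕ) → 1 ≤ r → KRamseyAtMost r s t ((M + 1) * r + m ∸ 1))
    ×
    (∀ (s R : ℕ) → 3 ≤ s → IsRamseyNumber s (s ∸ 1) R →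
       ∀ (r : ℕ) → 1 ≤ r → KRamseyAtMost r s s ((R + 1) * r + R ∸ 1))
theorem1p7 =
  (λ s t M m 3≤s 3≤t M-ramsey m-ramsey m≤M r 1≤r →
     bound 3≤s 3≤t (proj₁ M-ramsey) (proj₁ m-ramsey) m≤M 1≤r) ,
  (λ s R 3≤s R-ramsey r 1≤r →
     bound 3≤s 3≤s (Arrows-sym (proj₁ R-ramsey)) (proj₁ R-ramsey) ≤-refl 1≤r)
  where
  bound : ∀ {s t M m r} → 3 ≤ s → 3 ≤ t → Arrows M (s ∸ 1) t → Arrows m s (t ∸ 1) → m ≤ M → 1 ≤ r →
          KRamseyAtMost r s t ((M + 1) * r + m ∸ 1)
  bound (s≤s _) (s≤s (s≤s _)) arrowsM arrowsm m≤M 1≤r =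
    _ , ≤-refl , kneser-arrows 1≤r (Arrows⇒1≤ arrowsm) m≤M arrowsM arrowsm
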